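{- Let $N\ge2$. There exists a constant $c>0$ depending only on $N$ such that $f'_N(R)/f_N(R)\ge c$ for all sufficiently large $R$, where $f_N(R)=\#\{\Gamma\in\mathcal{R}_N:\lambda_N(\Gamma)\le R\}$ and $f'_N(R)=\#\{\Gamma\in\mathcal{R}'_N:\lambda_N(\Gamma)\le R\}$.
   Context: $\operatorname{rot}(x_1,\dots,x_N)=(x_N,x_1,\dots,x_{N-1})$. A sublattice $\Gamma\subseteq\mathbb{Z}^N$ is cyclic if $\operatorname{rot}(\Gamma)=\Gamma$; $\mathcal{C}_N$ is the set of full-rank cyclic sublattices of $\mathbb{Z}^N$. For $a\in\mathbb{R}^N$, $\Lambda(a)=\operatorname{span}_{\mathbb{Z}}\{a,\operatorname{rot}(a),\dots,\operatorname{rot}^{N-1}(a)\}$ and the cyclic order $\operatorname{co}(a)$ is the rank of $\Lambda(a)$. $\lambda_i$ are successive minima (Euclidean norm) and $S(\Gamma)$ is the set of vectors of $\Gamma$ of norm $\lambda_1(\Gamma)$. $\mathcal{R}_N=\{\Lambda(a)\in\mathcal{C}_N:\|a\|=\lambda_1(\Lambda(a))=\lambda_N(\Lambda(a))\}$ and $\mathcal{R}'_N=\{\Gamma\in\mathcal{R}_N:\operatorname{co}(c)=N\text{ for all }c\in S(\Gamma)\}$. -}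

module Defs where

open import Level using (Level) renaming (suc to lsuc; zero to lzero)
open import Data.Nat as ℕ using (ℕ; zero; suc) renaming (_+_ to _+ℕ_; _*_ to _*ℕ_; _≤_ to _≤ℕ_)
open import Data.Integer using (ℤ; _+_; _*_; ∣_∣) renaming (0ℤ to 0ℤ)
open import Data.Fin using (Fin; zero; suc; fromℕ; inject₁; toℕ)
open import Data.Product using (Σ; _×_; _,_; ∃)
open import Relation.Binary.PropositionalEquality using (_≡_)
open import Relation.Nullary using (¬_)

V : ℕ → Set
V N = Fin N → ℤ

_≋_ : ∀ {N} → V N → V N → Set
x ≋ y = ∀ i → x i ≡ y i

0V : ∀ {N} → V N
0V _ = 0ℤ

-- rot(x₁,…,x_N) = (x_N, x₁, …, x_{N-1})
rot : ∀ {N} → V N → V N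
rot {zero}  x ()
rot {suc n} x zero    = x (fromℕ n)
rot {suc n} x (suc i) = x (inject₁ i)

rotPow : ∀ {N} → ℕ → V N → V N
rotPow zero    x = x
rotPow (suc j) x = rot (rotPow j x)

sumℤ : ∀ {k} → (Fin k → ℤ) → ℤ
sumℤ {zero}  f = 0ℤ
sumℤ {suc k} f = f zero + sumℤ (λ j → f (suc j))

sumℕ : ∀ {k} → (Fin k → ℕ) → ℕ
sumℕ {zero}  f = 0
sumℕ {suc k} f = f zero +ℕ sumℕ (λ j → f (suc j))

normSq : ∀ {N} → V N → ℕ
normSq x = sumℕ (λ i → ∣ x i ∣ *ℕ ∣ x i ∣)

lincomb : ∀ {k N} → (Fin k → ℤ) → (Fin k → V N) → V N
lincomb c v i = sumℤ (λ j → c j * v j i)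

-- linear independence (over ℤ, equivalently over ℝ for integer vectors)
LinIndep : ∀ {k N} → (Fin k → V N) → Set
LinIndep v = ∀ c → lincomb c v ≋ 0V → ∀ j → c j ≡ 0ℤ

Sub : ℕ → Set₁
Sub N = V N → Set

_≐_ : ∀ {N} → Sub N → Sub N → Set
Γ ≐ Δ = ∀ x → (Γ x → Δ x) × (Δ x → Γ x)

Λ : ∀ {N} → V N → Sub N
Λ {N} a x = Σ (Fin N → ℤ) λ c → x ≋ lincomb c (λ j → rotPow (toℕ j) a)

HasIndep : ∀ {N} → Sub N → ℕ → Set
HasIndep {N} Γ k = Σ (Fin k → V N) λ v → (∀ j → Γ (v j)) × LinIndep v

HasRank : ∀ {N} → Sub N → ℕ → Set
HasRank Γ k = HasIndep Γ k × (∀ m → HasIndep Γ m → m ≤ℕ k)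

-- cyclic order: co(a) = k  iff  rank Λ(a) = k
CoEq : ∀ {N} → V N → ℕ → Set
CoEq a k = HasRank (Λ a) k

HasIndepBelow : ∀ {N} → Sub N → ℕ → ℕ → Set
HasIndepBelow {N} Γ i r =
  Σ (Fin i → V N) λ v → (∀ j → Γ (v j)) × (∀ j → normSq (v j) ≤ℕ r) × LinIndep v

-- λ_i(Γ)² = r  (successive minima are attained; their squares are integers)
LambdaSqEq : ∀ {N} → Sub N → ℕ → ℕ → Set
LambdaSqEq Γ i r = HasIndepBelow Γ i r × (∀ r' → HasIndepBelow Γ i r' → r ≤ℕ r')

InS : ∀ {N} → Sub N → V N → Set
InS Γ c = Γ c × LambdaSqEq Γ 1 (normSq c)

-- Γ ∈ 𝓡_N : Γ = Λ(a) ∈ 𝓒_N with ‖a‖ = λ₁(Λ(a)) = λ_N(Λ(a)).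
-- (Λ(a) ⊆ ℤ^N forces a ∈ ℤ^N since a ∈ Λ(a); Λ(a) is cyclic by construction;
--  membership in 𝓒_N then amounts to full rank.)
InR : (N : ℕ) → Sub N → Set
InR N Γ = Σ (V N) λ a → (Γ ≐ Λ a) × HasRank (Λ a) N
          × LambdaSqEq (Λ a) 1 (normSq a) × LambdaSqEq (Λ a) N (normSq a)

InR' : (N : ℕ) → Sub N → Set
InR' N Γ = InR N Γ × (∀ c → InS Γ c → CoEq c N)

LambdaNSqLe : (N : ℕ) → Sub N → ℕ → Set
LambdaNSqLe N Γ T = Σ ℕ λ r → LambdaSqEq Γ N r × r ≤ℕ T

-- Count P n : the collection of subsets satisfying P (up to extensional
-- equality) has exactly n elements.
Count : ∀ {N} → (Sub N → Set) → ℕ → Set₁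
Count {N} P n =
  Σ (Fin n → Sub N) λ L → (∀ j → P (L j))
    × (∀ i j → L i ≐ L j → i ≡ j)
    × (∀ Γ → P Γ → ∃ λ j → Γ ≐ L j)

-- f_N and f'_N with R² ≤ T replaced by integer bound T on λ_N²
fCount : (N : ℕ) → ℕ → ℕ → Set₁
fCount N T m = Count (λ Γ → InR N Γ × LambdaNSqLe N Γ T) m

f'Count : (N : ℕ) → ℕ → ℕ → Set₁
f'Count N T m = Count (λ Γ → InR' N Γ × LambdaNSqLe N Γ T) m

{-# OPTIONS --safe #-}

-- Upper bound: Γ = Λ(a) ∈ 𝓡_N has ‖a‖ = λ_N(Γ) ≤ R, so Γ is determined by an integer vector
-- with entries in [−R, R], and f_N(R) ≤ (2R + 1)^N.
-- Lower bound: call b dominant if one entry has size A ≥ 8NB and all others are at most B.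
-- The rotations of b are then almost orthogonal: every integer combination of them other
-- than ±rot^j b is strictly longer than b. So Λ(b) has rank N, λ₁ = λ_N = ‖b‖, and its
-- shortest vectors ±rot^j b are dominant again, hence of cyclic order N: Λ(b) ∈ 𝓡'_N.
-- The vectors (8Nq + t₀, t₁ − q, …, t_{N−1} − q) with 0 ≤ tᵢ ≤ 2q and q = ⌊R/17N⌋ give
-- (2q + 1)^N distinct such lattices with λ_N ≤ R, and (2R + 1)^N ≤ (34N)^N (2q + 1)^N.
module Submission where

open import Defs
open import Data.Nat using (ℕ; suc; _*_; _≤_)
open import Data.Product using (Σ)

open import Data.Nat using (zero; _+_; _<_; _∸_; _^_; z≤n; s≤s; NonZero; >-nonZero)
import Data.Nat.Properties as ℕP
open import Data.Nat.DivMod using (_/_; _%_; m/n*n≤m; m≥n⇒m/n>0; m≡m%n+[m/n]*n; m%n<n)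
open import Data.Nat.DivMod using (m<n⇒m%n≡m; [m+n]%n≡m%n; %-distribˡ-+; m%n%n≡m%n; m≤n⇒[n∸m]%m≡n%m)
open import Data.Integer as ℤ using (ℤ; -[1+_]; -_; ∣_∣; 0ℤ; 1ℤ)
  renaming (_+_ to _+ℤ_; _*_ to _*ℤ_; _-_ to _-ℤ_)
import Data.Integer.Properties as ℤP
open import Data.Fin using (Fin; zero; suc; toℕ; fromℕ; fromℕ<; inject₁; punchIn; punchOut; combine; funToFin; finToFun)
import Data.Fin.Properties as FinP
open import Data.Product using (_×_; _,_; proj₁; proj₂; ∃)
open import Data.Sum using ([_,_]′)
open import Data.Empty using (⊥-elim)
open import Data.Vec.Functional using (insertAt)
open import Data.Vec.Functional.Properties using (insertAt-lookup; insertAt-punchIn)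
open import Data.List using (_∷_; [])
open import Function using (_∘_; id)
open import Relation.Nullary using (¬_; yes; no; ¬?; _×-dec_)
open import Relation.Binary.PropositionalEquality
open import Relation.Binary.Definitions using (tri<; tri≈; tri>)
import Algebra.Properties.Semiring.Sum as SemiringSum
import Data.Integer.Tactic.RingSolver as ℤSolver
import Data.Nat.Tactic.RingSolver as ℕSolver

private
  module ∑ℤ = SemiringSum ℤP.+-*-semiring
  module ∑ℕ = SemiringSum ℕP.+-*-semiring

sumℤ≡sum : ∀ {k} (f : Fin k → ℤ) → sumℤ f ≡ ∑ℤ.sum f
sumℤ≡sum {zero}  f = refl
sumℤ≡sum {suc k} f = cong (f zero +ℤ_) (sumℤ≡sum (f ∘ suc))

sumℕ≡sum : ∀ {k} (f : Fin k → ℕ) → sumℕ f ≡ ∑ℕ.sum f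
sumℕ≡sum {zero}  f = refl
sumℕ≡sum {suc k} f = cong (f zero +_) (sumℕ≡sum (f ∘ suc))

sumℤ-cong : ∀ {k} {f g : Fin k → ℤ} → (∀ j → f j ≡ g j) → sumℤ f ≡ sumℤ g
sumℤ-cong {f = f} {g} f≗g =
  trans (sumℤ≡sum f) (trans (∑ℤ.sum-cong-≗ f≗g) (sym (sumℤ≡sum g)))

sumℕ-cong : ∀ {k} {f g : Fin k → ℕ} → (∀ j → f j ≡ g j) → sumℕ f ≡ sumℕ g
sumℕ-cong {f = f} {g} f≗g =
  trans (sumℕ≡sum f) (trans (∑ℕ.sum-cong-≗ f≗g) (sym (sumℕ≡sum g)))

sumℤ-zero : ∀ {k} {f : Fin k → ℤ} → (∀ j → f j ≡ 0ℤ) → sumℤ f ≡ 0ℤ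
sumℤ-zero {zero}  f≗0 = refl
sumℤ-zero {suc k} f≗0 = cong₂ _+ℤ_ (f≗0 zero) (sumℤ-zero (f≗0 ∘ suc))

sumℕ-zero : ∀ {k} {f : Fin k → ℕ} → (∀ j → f j ≡ 0) → sumℕ f ≡ 0
sumℕ-zero {zero}  f≗0 = refl
sumℕ-zero {suc k} f≗0 = cong₂ _+_ (f≗0 zero) (sumℕ-zero (f≗0 ∘ suc))

sumℤ-distrib-+ : ∀ {k} (f g : Fin k → ℤ) → sumℤ (λ j → f j +ℤ g j) ≡ sumℤ f +ℤ sumℤ g
sumℤ-distrib-+ f g = trans (sumℤ≡sum (λ j → f j +ℤ g j))
  (trans (∑ℤ.∑-distrib-+ f g) (sym (cong₂ _+ℤ_ (sumℤ≡sum f) (sumℤ≡sum g))))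

*-distribˡ-sumℤ : ∀ {k} a (f : Fin k → ℤ) → a *ℤ sumℤ f ≡ sumℤ (λ j → a *ℤ f j)
*-distribˡ-sumℤ a f = trans (cong (a *ℤ_) (sumℤ≡sum f))
  (trans (∑ℤ.*-distribˡ-sum a f) (sym (sumℤ≡sum (λ j → a *ℤ f j))))

sumℤ-remove : ∀ {k} (f : Fin (suc k) → ℤ) p → sumℤ f ≡ f p +ℤ sumℤ (f ∘ punchIn p)
sumℤ-remove f p = trans (sumℤ≡sum f)
  (trans (∑ℤ.sum-remove f) (sym (cong (f p +ℤ_) (sumℤ≡sum (f ∘ punchIn p)))))

sumℕ-remove : ∀ {k} (f : Fin (suc k) → ℕ) p → sumℕ f ≡ f p + sumℕ (f ∘ punchIn p)
sumℕ-remove f p = trans (sumℕ≡sum f)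
  (trans (∑ℕ.sum-remove f) (sym (cong (f p +_) (sumℕ≡sum (f ∘ punchIn p)))))

sumℕ-init-last : ∀ {k} (f : Fin (suc k) → ℕ) → sumℕ f ≡ sumℕ (f ∘ inject₁) + f (fromℕ k)
sumℕ-init-last f = trans (sumℕ≡sum f)
  (trans (∑ℕ.sum-init-last f) (sym (cong (_+ f (fromℕ _)) (sumℕ≡sum (f ∘ inject₁)))))

sumℤ-single : ∀ {k} (f : Fin (suc k) → ℤ) p → (∀ j → j ≢ p → f j ≡ 0ℤ) → sumℤ f ≡ f p
sumℤ-single f p f≡0 = begin
  sumℤ f                          ≡⟨ sumℤ-remove f p ⟩
  f p +ℤ sumℤ (f ∘ punchIn p)     ≡⟨ cong (f p +ℤ_) (sumℤ-zero λ k → f≡0 _ (FinP.punchInᵢ≢i p k)) ⟩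
  f p +ℤ 0ℤ                       ≡⟨ ℤP.+-identityʳ (f p) ⟩
  f p                             ∎
  where open ≡-Reasoning

sumℕ≤*-bound : ∀ {k} {f : Fin k → ℕ} c → (∀ j → f j ≤ c) → sumℕ f ≤ k * c
sumℕ≤*-bound {zero}  c f≤c = z≤n
sumℕ≤*-bound {suc k} c f≤c = ℕP.+-mono-≤ (f≤c zero) (sumℕ≤*-bound c (f≤c ∘ suc))

term≤sumℕ : ∀ {k} (f : Fin k → ℕ) p → f p ≤ sumℕ f
term≤sumℕ f zero    = ℕP.m≤m+n _ _
term≤sumℕ f (suc p) = ℕP.≤-trans (term≤sumℕ (f ∘ suc) p) (ℕP.m≤n+m _ (f zero))

two-terms≤sumℕ : ∀ {k} (f : Fin (suc k) → ℕ) {p q} → p ≢ q → f p + f q ≤ sumℕ f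
two-terms≤sumℕ f {p} {q} p≢q = subst (f p + f q ≤_) (sym (sumℕ-remove f p))
  (ℕP.+-monoʳ-≤ (f p) (subst (_≤ sumℕ (f ∘ punchIn p)) (cong f (FinP.punchIn-punchOut p≢q))
    (term≤sumℕ (f ∘ punchIn p) (punchOut p≢q))))

∣sumℤ∣≤sumℕ∣∣ : ∀ {k} (f : Fin k → ℤ) → ∣ sumℤ f ∣ ≤ sumℕ (λ j → ∣ f j ∣)
∣sumℤ∣≤sumℕ∣∣ {zero}  f = z≤n
∣sumℤ∣≤sumℕ∣∣ {suc k} f = ℕP.≤-trans (ℤP.∣i+j∣≤∣i∣+∣j∣ (f zero) _)
  (ℕP.+-monoʳ-≤ ∣ f zero ∣ (∣sumℤ∣≤sumℕ∣∣ (f ∘ suc)))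

argmax : ∀ {k} (f : Fin (suc k) → ℕ) → ∃ λ j → ∀ l → f l ≤ f j
argmax {zero}  f = zero , λ { zero → ℕP.≤-refl }
argmax {suc k} f with argmax (f ∘ suc)
... | j , f∘suc≤ with f zero ℕP.≤? f (suc j)
...   | yes f0≤ = suc j , λ { zero → f0≤ ; (suc l) → f∘suc≤ l }
...   | no  f0≰ = zero , λ { zero → ℕP.≤-refl ; (suc l) → ℕP.≤-trans (f∘suc≤ l) (ℕP.<⇒≤ (ℕP.≰⇒> f0≰)) }

lincomb-single : ∀ {k N} (γ : Fin (suc k) → ℤ) (v : Fin (suc k) → V N) j →
  (∀ l → l ≢ j → γ l ≡ 0ℤ) → ∀ i → lincomb γ v i ≡ γ j *ℤ v j i
lincomb-single γ v j γ≡0 i = sumℤ-single (λ l → γ l *ℤ v l i) j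
  λ l l≢j → trans (cong (_*ℤ v l i) (γ≡0 l l≢j)) (ℤP.*-zeroˡ (v l i))

unitVec : ∀ {k} → Fin k → Fin k → ℤ
unitVec {suc k} j = insertAt (λ _ → 0ℤ) j 1ℤ

unitVec-≢ : ∀ {k} (j l : Fin k) → l ≢ j → unitVec j l ≡ 0ℤ
unitVec-≢ {suc k} j l l≢j =
  trans (cong (unitVec j) (sym (FinP.punchIn-punchOut (l≢j ∘ sym)))) (insertAt-punchIn _ j 1ℤ _)

lincomb-unitVec : ∀ {k N} (v : Fin k → V N) j → lincomb (unitVec j) v ≋ v j
lincomb-unitVec {suc k} v j i = begin
  lincomb (unitVec j) v i    ≡⟨ lincomb-single (unitVec j) v j (unitVec-≢ j) i ⟩
  unitVec j j *ℤ v j i       ≡⟨ cong (_*ℤ v j i) (insertAt-lookup _ j 1ℤ) ⟩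
  1ℤ *ℤ v j i                ≡⟨ ℤP.*-identityˡ (v j i) ⟩
  v j i                      ∎
  where open ≡-Reasoning

LinIndep⇒≉0 : ∀ {k N} {v : Fin k → V N} → LinIndep v → ∀ j → ¬ (v j ≋ 0V)
LinIndep⇒≉0 {suc k} {v = v} indep j vj≋0 = 1≢0 (trans (sym (insertAt-lookup _ j 1ℤ))
  (indep (unitVec j) (λ i → trans (lincomb-unitVec v j i) (vj≋0 i)) j))
  where
  1≢0 : 1ℤ ≢ 0ℤ
  1≢0 ()

LinIndep-single : ∀ {N} {x : V N} i → x i ≢ 0ℤ → LinIndep (λ (_ : Fin 1) → x)
LinIndep-single {x = x} i xi≢0 c c·x≋0 zero =
  [ id , ⊥-elim ∘ xi≢0 ]′
    (ℤP.i*j≡0⇒i≡0∨j≡0 (c zero) (trans (sym (ℤP.+-identityʳ _)) (c·x≋0 i)))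

LinDep : ∀ {m N} → (Fin m → V N) → Set
LinDep {m} v = Σ (Fin m → ℤ) λ c → lincomb c v ≋ 0V × ∃ λ j → c j ≢ 0ℤ

LinDep-dropHead : ∀ {m n} {v : Fin m → V (suc n)} → (∀ j → v j zero ≡ 0ℤ) →
  LinDep (λ j i → v j (suc i)) → LinDep v
LinDep-dropHead {v = v} head≡0 (c , c·v≋0 , j , cj≢0) = c , c·v≋0′ , j , cj≢0
  where
  c·v≋0′ : lincomb c v ≋ 0V
  c·v≋0′ zero    = sumℤ-zero λ j → trans (cong (c j *ℤ_) (head≡0 j)) (ℤP.*-zeroʳ (c j))
  c·v≋0′ (suc i) = c·v≋0 i

-- One step of fraction-free Gaussian elimination on the first coordinate, with pivot v p.
module Elimination {m n} (v : Fin (suc m) → V (suc n)) (p : Fin (suc m))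
                   (pivot≢0 : v p zero ≢ 0ℤ) where

  W : Fin m → V (suc n)
  W k i = v p zero *ℤ v (punchIn p k) i -ℤ v (punchIn p k) zero *ℤ v p i

  W-head≡0 : ∀ k → W k zero ≡ 0ℤ
  W-head≡0 k = trans (cong (_-ℤ vₖ *ℤ vₚ) (ℤP.*-comm vₚ vₖ)) (ℤP.+-inverseʳ (vₖ *ℤ vₚ))
    where
    vₚ = v p zero
    vₖ = v (punchIn p k) zero

  lift : (Fin m → ℤ) → Fin (suc m) → ℤ
  lift e = insertAt (λ k → e k *ℤ v p zero) p (- sumℤ (λ k → e k *ℤ v (punchIn p k) zero))

  lincomb-lift : ∀ e → lincomb (lift e) v ≋ lincomb e W
  lincomb-lift e i = begin
    sumℤ (λ j → lift e j *ℤ v j i)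
      ≡⟨ sumℤ-remove (λ j → lift e j *ℤ v j i) p ⟩
    lift e p *ℤ v p i +ℤ sumℤ (λ k → lift e (punchIn p k) *ℤ v (punchIn p k) i)
      ≡⟨ cong₂ _+ℤ_ (cong (_*ℤ v p i) (insertAt-lookup _ p _))
                    (sumℤ-cong λ k → cong (_*ℤ v (punchIn p k) i) (insertAt-punchIn _ p _ k)) ⟩
    - sumℤ l *ℤ v p i +ℤ sumℤ (λ k → e k *ℤ d *ℤ v (punchIn p k) i)
      ≡⟨ cong (_+ℤ sumℤ (λ k → e k *ℤ d *ℤ v (punchIn p k) i))
              (trans (neg*≡*neg (sumℤ l) (v p i)) (*-distribˡ-sumℤ (- v p i) l)) ⟩
    sumℤ (λ k → - v p i *ℤ l k) +ℤ sumℤ (λ k → e k *ℤ d *ℤ v (punchIn p k) i)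
      ≡⟨ sym (sumℤ-distrib-+ (λ k → - v p i *ℤ l k) (λ k → e k *ℤ d *ℤ v (punchIn p k) i)) ⟩
    sumℤ (λ k → - v p i *ℤ l k +ℤ e k *ℤ d *ℤ v (punchIn p k) i)
      ≡⟨ sumℤ-cong (λ k → regroup (e k) d (v (punchIn p k) zero) (v (punchIn p k) i) (v p i)) ⟩
    sumℤ (λ k → e k *ℤ W k i) ∎
    where
    open ≡-Reasoning
    d = v p zero
    l : Fin m → ℤ
    l k = e k *ℤ v (punchIn p k) zero
    neg*≡*neg : ∀ s y → - s *ℤ y ≡ - y *ℤ s
    neg*≡*neg = ℤSolver.solve-∀
    regroup : ∀ a b c x y → - y *ℤ (a *ℤ c) +ℤ a *ℤ b *ℤ x ≡ a *ℤ (b *ℤ x -ℤ c *ℤ y)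
    regroup = ℤSolver.solve-∀

  LinDep-lift : LinDep (λ k i → W k (suc i)) → LinDep v
  LinDep-lift dep with LinDep-dropHead {v = W} W-head≡0 dep
  ... | e , e·W≋0 , k , ek≢0 =
    lift e , (λ i → trans (lincomb-lift e i) (e·W≋0 i)) , punchIn p k , lift≢0
    where
    lift≢0 : lift e (punchIn p k) ≢ 0ℤ
    lift≢0 eq = [ ek≢0 , pivot≢0 ]′
      (ℤP.i*j≡0⇒i≡0∨j≡0 (e k) (trans (sym (insertAt-punchIn _ p _ k)) eq))

dim<⇒LinDep : ∀ {N m} → N < m → (v : Fin m → V N) → LinDep v
dim<⇒LinDep {zero} {suc m} _ v = (λ _ → 1ℤ) , (λ ()) , zero , λ ()
dim<⇒LinDep {suc n} {suc m} (s≤s n<m) v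
  with FinP.any? (λ p → ¬? (v p zero ℤP.≟ 0ℤ))
... | yes (p , pivot≢0) =
  Elimination.LinDep-lift v p pivot≢0 (dim<⇒LinDep n<m _)
... | no no-pivot =
  LinDep-dropHead {v = v} head≡0 (dim<⇒LinDep (ℕP.m<n⇒m<1+n n<m) (λ j i → v j (suc i)))
  where
  head≡0 : ∀ j → v j zero ≡ 0ℤ
  head≡0 j with v j zero ℤP.≟ 0ℤ
  ... | yes vj≡0 = vj≡0
  ... | no  vj≢0 = ⊥-elim (no-pivot (j , vj≢0))

HasIndep⇒≤dim : ∀ {N} {Γ : Sub N} {m} → HasIndep Γ m → m ≤ N
HasIndep⇒≤dim {N} {m = m} (v , _ , indep) with m ℕP.≤? N
... | yes m≤N = m≤N
... | no  m≰N with dim<⇒LinDep (ℕP.≰⇒> m≰N) v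
...   | c , c·v≋0 , j , cj≢0 = ⊥-elim (cj≢0 (indep c c·v≋0 j))

normSq-∣≡∣ : ∀ {N} {x y : V N} → (∀ i → ∣ x i ∣ ≡ ∣ y i ∣) → normSq x ≡ normSq y
normSq-∣≡∣ ∣x∣≡∣y∣ = sumℕ-cong λ i → cong₂ _*_ (∣x∣≡∣y∣ i) (∣x∣≡∣y∣ i)

normSq-≋ : ∀ {N} {x y : V N} → x ≋ y → normSq x ≡ normSq y
normSq-≋ {x = x} {y} x≋y = normSq-∣≡∣ {x = x} {y} (cong ∣_∣ ∘ x≋y)

normSq-≋0 : ∀ {N} {x : V N} → x ≋ 0V → normSq x ≡ 0
normSq-≋0 {N} {x} x≋0 = trans (normSq-≋ {x = x} {0V} x≋0) (sumℕ-zero {N} {λ _ → 0} λ _ → refl)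

square≤normSq : ∀ {N} (x : V N) i → ∣ x i ∣ * ∣ x i ∣ ≤ normSq x
square≤normSq x = term≤sumℕ (λ i → ∣ x i ∣ * ∣ x i ∣)

∣unit*x∣≡∣x∣ : ∀ {ε} x → ∣ ε ∣ ≡ 1 → ∣ ε *ℤ x ∣ ≡ ∣ x ∣
∣unit*x∣≡∣x∣ {ε} x ∣ε∣≡1 =
  trans (ℤP.abs-* ε x) (trans (cong (_* ∣ x ∣) ∣ε∣≡1) (ℕP.*-identityˡ ∣ x ∣))

[m%n+k]%n≡[m+k]%n : ∀ m k n .{{_ : NonZero n}} → (m % n + k) % n ≡ (m + k) % n
[m%n+k]%n≡[m+k]%n m k n = begin
  (m % n + k) % n         ≡⟨ %-distribˡ-+ (m % n) k n ⟩
  (m % n % n + k % n) % n ≡⟨ cong (λ r → (r + k % n) % n) (m%n%n≡m%n m n) ⟩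
  (m % n + k % n) % n     ≡⟨ %-distribˡ-+ m k n ⟨
  (m + k) % n             ∎
  where open ≡-Reasoning

[m+d]%n≢m%n : ∀ m d n .{{_ : NonZero n}} → 0 < d → d < n → (m + d) % n ≢ m % n
[m+d]%n≢m%n m d n 0<d d<n eq with m % n + d ℕP.<? n
... | yes r+d<n = ℕP.<⇒≢ (ℕP.m<m+n (m % n) 0<d) (begin
  m % n               ≡⟨ eq ⟨
  (m + d) % n         ≡⟨ [m%n+k]%n≡[m+k]%n m d n ⟨
  (m % n + d) % n     ≡⟨ m<n⇒m%n≡m r+d<n ⟩
  m % n + d           ∎)
  where open ≡-Reasoning
... | no r+d≮n = ℕP.<⇒≢ d<n (ℕP.+-cancelˡ-≡ (m % n) _ _ (begin
  m % n + d                 ≡⟨ ℕP.m+[n∸m]≡n n≤r+d ⟨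
  n + (m % n + d ∸ n)       ≡⟨ cong (n +_) wrapped ⟩
  n + m % n                 ≡⟨ ℕP.+-comm n (m % n) ⟩
  m % n + n                 ∎))
  where
  open ≡-Reasoning
  n≤r+d : n ≤ m % n + d
  n≤r+d = ℕP.≮⇒≥ r+d≮n
  r+d∸n<n : m % n + d ∸ n < n
  r+d∸n<n = ℕP.+-cancelˡ-< n _ _ (subst (_< n + n) (sym (ℕP.m+[n∸m]≡n n≤r+d))
                                        (ℕP.+-mono-< (m%n<n m n) d<n))
  wrapped : m % n + d ∸ n ≡ m % n
  wrapped = begin
    m % n + d ∸ n             ≡⟨ m<n⇒m%n≡m r+d∸n<n ⟨
    (m % n + d ∸ n) % n       ≡⟨ m≤n⇒[n∸m]%m≡n%m n≤r+d ⟩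
    (m % n + d) % n           ≡⟨ [m%n+k]%n≡[m+k]%n m d n ⟩
    (m + d) % n               ≡⟨ eq ⟩
    m % n                     ∎

predMod : ∀ {n} → Fin (suc n) → Fin (suc n)
predMod {n} zero = fromℕ n
predMod (suc i)  = inject₁ i

rot≡∘predMod : ∀ {n} (x : V (suc n)) i → rot x i ≡ x (predMod i)
rot≡∘predMod x zero    = refl
rot≡∘predMod x (suc i) = refl

predMod-injective : ∀ {n} {i j : Fin (suc n)} → predMod i ≡ predMod j → i ≡ j
predMod-injective {i = zero}  {zero}  _  = refl
predMod-injective {i = zero}  {suc j} eq = ⊥-elim (FinP.fromℕ≢inject₁ eq)
predMod-injective {i = suc i} {zero}  eq = ⊥-elim (FinP.fromℕ≢inject₁ (sym eq))
predMod-injective {i = suc i} {suc j} eq = cong suc (FinP.inject₁-injective eq)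

toℕ-predMod : ∀ {n} (i : Fin (suc n)) → toℕ (predMod i) ≡ (toℕ i + n) % suc n
toℕ-predMod {n} zero    = trans (FinP.toℕ-fromℕ n) (sym (m<n⇒m%n≡m (ℕP.n<1+n n)))
toℕ-predMod {n} (suc i) = begin
  toℕ (inject₁ i)          ≡⟨ FinP.toℕ-inject₁ i ⟩
  toℕ i                    ≡⟨ m<n⇒m%n≡m (ℕP.m<n⇒m<1+n (FinP.toℕ<n i)) ⟨
  toℕ i % suc n            ≡⟨ [m+n]%n≡m%n (toℕ i) (suc n) ⟨
  (toℕ i + suc n) % suc n  ≡⟨ cong (_% suc n) (ℕP.+-suc (toℕ i) n) ⟩
  (suc (toℕ i) + n) % suc n ∎
  where open ≡-Reasoning

shift : ∀ {n} → Fin (suc n) → ℕ → Fin (suc n)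
shift {n} p j = fromℕ< (m%n<n (toℕ p + j) (suc n))

toℕ-shift : ∀ {n} (p : Fin (suc n)) j → toℕ (shift p j) ≡ (toℕ p + j) % suc n
toℕ-shift p j = FinP.toℕ-fromℕ< _

shift-zero : ∀ {n} (p : Fin (suc n)) → shift p 0 ≡ p
shift-zero {n} p = FinP.toℕ-injective (begin
  toℕ (shift p 0)        ≡⟨ toℕ-shift p 0 ⟩
  (toℕ p + 0) % suc n    ≡⟨ cong (_% suc n) (ℕP.+-identityʳ (toℕ p)) ⟩
  toℕ p % suc n          ≡⟨ m<n⇒m%n≡m (FinP.toℕ<n p) ⟩
  toℕ p                  ∎)
  where open ≡-Reasoning

predMod-shift-suc : ∀ {n} (p : Fin (suc n)) j → predMod (shift p (suc j)) ≡ shift p j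
predMod-shift-suc {n} p j = FinP.toℕ-injective (begin
  toℕ (predMod (shift p (suc j)))        ≡⟨ toℕ-predMod (shift p (suc j)) ⟩
  (toℕ (shift p (suc j)) + n) % suc n    ≡⟨ cong (λ r → (r + n) % suc n) (toℕ-shift p (suc j)) ⟩
  ((toℕ p + suc j) % suc n + n) % suc n  ≡⟨ [m%n+k]%n≡[m+k]%n (toℕ p + suc j) n (suc n) ⟩
  (toℕ p + suc j + n) % suc n            ≡⟨ cong (_% suc n) (reassoc (toℕ p) j n) ⟩
  (toℕ p + j + suc n) % suc n            ≡⟨ [m+n]%n≡m%n (toℕ p + j) (suc n) ⟩
  (toℕ p + j) % suc n                    ≡⟨ toℕ-shift p j ⟨
  toℕ (shift p j)                        ∎)
  where
  open ≡-Reasoning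
  reassoc : ∀ a b c → a + suc b + c ≡ a + b + suc c
  reassoc = ℕSolver.solve-∀

shift-<⇒≢ : ∀ {n} (p : Fin (suc n)) {j j'} → j < j' → j' < suc n → shift p j' ≢ shift p j
shift-<⇒≢ {n} p {j} {j'} j<j' j'<N eq = [m+d]%n≢m%n (toℕ p + j) (j' ∸ j) (suc n)
  (ℕP.m<n⇒0<n∸m j<j') (ℕP.≤-<-trans (ℕP.m∸n≤m j' j) j'<N) (begin
    (toℕ p + j + (j' ∸ j)) % suc n  ≡⟨ cong (_% suc n) j+[j'∸j]≡j' ⟩
    (toℕ p + j') % suc n           ≡⟨ toℕ-shift p j' ⟨
    toℕ (shift p j')               ≡⟨ cong toℕ eq ⟩
    toℕ (shift p j)                ≡⟨ toℕ-shift p j ⟩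
    (toℕ p + j) % suc n            ∎)
  where
  open ≡-Reasoning
  j+[j'∸j]≡j' : toℕ p + j + (j' ∸ j) ≡ toℕ p + j'
  j+[j'∸j]≡j' = trans (ℕP.+-assoc (toℕ p) j _) (cong (toℕ p +_) (ℕP.m+[n∸m]≡n (ℕP.<⇒≤ j<j')))

shift-injective : ∀ {n} (p : Fin (suc n)) {j j'} → j < suc n → j' < suc n →
  shift p j ≡ shift p j' → j ≡ j'
shift-injective p {j} {j'} j<N j'<N eq with ℕP.<-cmp j j'
... | tri< j<j' _ _ = ⊥-elim (shift-<⇒≢ p j<j' j'<N (sym eq))
... | tri≈ _ j≡j' _ = j≡j'
... | tri> _ _ j>j' = ⊥-elim (shift-<⇒≢ p j>j' j<N eq)

normSq-rot : ∀ {N} (x : V N) → normSq (rot x) ≡ normSq x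
normSq-rot {zero}  x = refl
normSq-rot {suc n} x = trans (ℕP.+-comm (x² (fromℕ n)) _) (sym (sumℕ-init-last x²))
  where
  x² : Fin (suc n) → ℕ
  x² i = ∣ x i ∣ * ∣ x i ∣

normSq-rotPow : ∀ {N} j (x : V N) → normSq (rotPow j x) ≡ normSq x
normSq-rotPow zero    x = refl
normSq-rotPow (suc j) x = trans (normSq-rot (rotPow j x)) (normSq-rotPow j x)

rot-cong : ∀ {N} {x y : V N} → x ≋ y → rot x ≋ rot y
rot-cong {suc n} x≋y zero    = x≋y (fromℕ n)
rot-cong {suc n} x≋y (suc i) = x≋y (inject₁ i)

rotPow-cong : ∀ {N} j {x y : V N} → x ≋ y → rotPow j x ≋ rotPow j y
rotPow-cong zero    x≋y = x≋y
rotPow-cong (suc j) x≋y = rot-cong (rotPow-cong j x≋y)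

≐-refl : ∀ {N} {Γ : Sub N} → Γ ≐ Γ
≐-refl x = id , id

≐-sym : ∀ {N} {Γ Δ : Sub N} → Γ ≐ Δ → Δ ≐ Γ
≐-sym Γ≐Δ x = proj₂ (Γ≐Δ x) , proj₁ (Γ≐Δ x)

≐-trans : ∀ {N} {Γ Δ Θ : Sub N} → Γ ≐ Δ → Δ ≐ Θ → Γ ≐ Θ
≐-trans Γ≐Δ Δ≐Θ x = proj₁ (Δ≐Θ x) ∘ proj₁ (Γ≐Δ x) , proj₂ (Γ≐Δ x) ∘ proj₂ (Δ≐Θ x)

Λ-cong : ∀ {N} {a b : V N} → a ≋ b → Λ a ≐ Λ b
Λ-cong a≋b x = (λ (c , x≋c·a) → c , λ i → trans (x≋c·a i) (lincomb-cong c i))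
             , (λ (c , x≋c·b) → c , λ i → trans (x≋c·b i) (sym (lincomb-cong c i)))
  where
  lincomb-cong : ∀ c i → lincomb c (λ j → rotPow (toℕ j) _) i ≡ lincomb c (λ j → rotPow (toℕ j) _) i
  lincomb-cong c i = sumℤ-cong λ j → cong (c j *ℤ_) (rotPow-cong (toℕ j) a≋b i)

HasIndepBelow-≐ : ∀ {N} {Γ Δ : Sub N} {k r} → Γ ≐ Δ → HasIndepBelow Γ k r → HasIndepBelow Δ k r
HasIndepBelow-≐ Γ≐Δ (v , v∈Γ , v≤r , indep) = v , (λ j → proj₁ (Γ≐Δ (v j)) (v∈Γ j)) , v≤r , indep

-- With A ≥ 8NB a dominant vector has squared norm at most 65A²/64, while one coordinate
-- of size ≥ 7·2A/8, or two of size ≥ 7A/8, already give more.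
module DominanceArithmetic {N A B : ℕ} .{{_ : NonZero N}} (8NB≤A : 8 * (N * B) ≤ A) where

  7/8-bound : ∀ M x → M * A ≤ x + N * (M * B) → 7 * (M * A) ≤ 8 * x
  7/8-bound M x MA≤x+NMB = ℕP.+-cancelʳ-≤ (M * A) (7 * (M * A)) (8 * x) (begin
    7 * (M * A) + M * A        ≡⟨ ℕSolver.solve (M ∷ A ∷ []) ⟩
    8 * (M * A)                ≤⟨ ℕP.*-monoʳ-≤ 8 MA≤x+NMB ⟩
    8 * (x + N * (M * B))      ≡⟨ ℕSolver.solve (x ∷ N ∷ M ∷ B ∷ []) ⟩
    8 * x + M * (8 * (N * B))  ≤⟨ ℕP.+-monoʳ-≤ (8 * x) (ℕP.*-monoʳ-≤ M 8NB≤A) ⟩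
    8 * x + M * A              ∎)
    where open ℕP.≤-Reasoning

  64[A²+NB²]≤65A² : 64 * (A * A + N * (B * B)) ≤ 65 * (A * A)
  64[A²+NB²]≤65A² = begin
    64 * (A * A + N * (B * B))                    ≡⟨ ℕSolver.solve (A ∷ N ∷ B ∷ []) ⟩
    64 * (A * A) + 64 * (N * (B * B))             ≤⟨ ℕP.+-monoʳ-≤ (64 * (A * A)) (ℕP.m≤m*n _ N) ⟩
    64 * (A * A) + 64 * (N * (B * B)) * N         ≡⟨ cong (64 * (A * A) +_) (ℕSolver.solve (N ∷ B ∷ [])) ⟩
    64 * (A * A) + (8 * (N * B)) * (8 * (N * B))  ≤⟨ ℕP.+-monoʳ-≤ (64 * (A * A)) (ℕP.*-mono-≤ 8NB≤A 8NB≤A) ⟩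
    64 * (A * A) + A * A                          ≡⟨ ℕSolver.solve (A ∷ []) ⟩
    65 * (A * A)                                  ∎
    where open ℕP.≤-Reasoning

  module _ (1≤A : 1 ≤ A) where

    private
      65A²<kA² : ∀ k → 66 ≤ k → 65 * (A * A) < k * (A * A)
      65A²<kA² k 66≤k = ℕP.*-monoˡ-< (A * A) {{>-nonZero (ℕP.*-mono-≤ 1≤A 1≤A)}} 66≤k

    A²+NB²<x² : ∀ x → 14 * A ≤ 8 * x → A * A + N * (B * B) < x * x
    A²+NB²<x² x 14A≤8x = ℕP.*-cancelˡ-< 64 _ _ (begin-strict
      64 * (A * A + N * (B * B))  ≤⟨ 64[A²+NB²]≤65A² ⟩
      65 * (A * A)                <⟨ 65A²<kA² 196 (ℕP.m≤m+n 66 130) ⟩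
      196 * (A * A)               ≡⟨ ℕSolver.solve (A ∷ []) ⟩
      (14 * A) * (14 * A)         ≤⟨ ℕP.*-mono-≤ 14A≤8x 14A≤8x ⟩
      (8 * x) * (8 * x)           ≡⟨ ℕSolver.solve (x ∷ []) ⟩
      64 * (x * x)                ∎)
      where open ℕP.≤-Reasoning

    A²+NB²<x²+y² : ∀ x y → 7 * A ≤ 8 * x → 7 * A ≤ 8 * y → A * A + N * (B * B) < x * x + y * y
    A²+NB²<x²+y² x y 7A≤8x 7A≤8y = ℕP.*-cancelˡ-< 64 _ _ (begin-strict
      64 * (A * A + N * (B * B))                ≤⟨ 64[A²+NB²]≤65A² ⟩
      65 * (A * A)                              <⟨ 65A²<kA² 98 (ℕP.m≤m+n 66 32) ⟩
      98 * (A * A)                              ≡⟨ ℕSolver.solve (A ∷ []) ⟩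
      (7 * A) * (7 * A) + (7 * A) * (7 * A)     ≤⟨ ℕP.+-mono-≤ (ℕP.*-mono-≤ 7A≤8x 7A≤8x) (ℕP.*-mono-≤ 7A≤8y 7A≤8y) ⟩
      (8 * x) * (8 * x) + (8 * y) * (8 * y)     ≡⟨ ℕSolver.solve (x ∷ y ∷ []) ⟩
      64 * (x * x + y * y)                      ∎)
      where open ℕP.≤-Reasoning

record DominantAt {N} (b : V N) (p : Fin N) (A B : ℕ) : Set where
  field
    peak≡ : ∣ b p ∣ ≡ A
    rest≤ : ∀ i → i ≢ p → ∣ b i ∣ ≤ B

open DominantAt

DominantAt-∣≡∣ : ∀ {N} {x y : V N} {p A B} → (∀ i → ∣ x i ∣ ≡ ∣ y i ∣) →
  DominantAt y p A B → DominantAt x p A B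
DominantAt-∣≡∣ ∣x∣≡∣y∣ dom = record
  { peak≡ = trans (∣x∣≡∣y∣ _) (peak≡ dom)
  ; rest≤ = λ i i≢p → subst (_≤ _) (sym (∣x∣≡∣y∣ i)) (rest≤ dom i i≢p) }

DominantAt-rot : ∀ {n} {b : V (suc n)} {p A B} → DominantAt b p A B →
  ∀ {q} → predMod q ≡ p → DominantAt (rot b) q A B
DominantAt-rot {b = b} dom {q} q-1≡p = record
  { peak≡ = trans (cong ∣_∣ (trans (rot≡∘predMod b q) (cong b q-1≡p))) (peak≡ dom)
  ; rest≤ = λ i i≢q → subst (_≤ _) (cong ∣_∣ (sym (rot≡∘predMod b i)))
      (rest≤ dom (predMod i) (λ i-1≡p → i≢q (predMod-injective (trans i-1≡p (sym q-1≡p))))) }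

DominantAt-rotPow : ∀ {n} {b : V (suc n)} {p A B} → DominantAt b p A B →
  ∀ j → DominantAt (rotPow j b) (shift p j) A B
DominantAt-rotPow {b = b} {p} {A} {B} dom zero =
  subst (λ q → DominantAt b q A B) (sym (shift-zero p)) dom
DominantAt-rotPow {p = p} dom (suc j) =
  DominantAt-rot (DominantAt-rotPow dom j) (predMod-shift-suc p j)

module Dominant {n A B : ℕ} (8NB≤A : 8 * (suc n * B) ≤ A) (1≤A : 1 ≤ A)
                {b : V (suc n)} {p : Fin (suc n)} (dom : DominantAt b p A B) where

  N : ℕ
  N = suc n

  open DominanceArithmetic {N} {A} {B} 8NB≤A

  rots : Fin N → V N
  rots j = rotPow (toℕ j) b

  peak : Fin N → Fin N
  peak j = shift p (toℕ j)

  rots-dominant : ∀ j → DominantAt (rots j) (peak j) A B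
  rots-dominant j = DominantAt-rotPow dom (toℕ j)

  peak-injective : ∀ {j l} → peak j ≡ peak l → j ≡ l
  peak-injective {j} {l} eq = FinP.toℕ-injective (shift-injective p (FinP.toℕ<n j) (FinP.toℕ<n l) eq)

  normSq-rots : ∀ j → normSq (rots j) ≡ normSq b
  normSq-rots j = normSq-rotPow (toℕ j) b

  rots∈Λ : ∀ j → Λ b (rots j)
  rots∈Λ j = unitVec j , λ i → sym (lincomb-unitVec rots j i)

  -- At position peak j every rotation other than rots j has an entry of size at most B.
  coordinate-estimate : ∀ (γ : Fin N → ℤ) M → (∀ l → ∣ γ l ∣ ≤ M) → ∀ j →
    ∣ γ j ∣ * A ≤ ∣ lincomb γ rots (peak j) ∣ + N * (M * B)
  coordinate-estimate γ M γ≤M j = begin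
    ∣ γ j ∣ * A                      ≡⟨ cong (∣ γ j ∣ *_) (peak≡ (rots-dominant j)) ⟨
    ∣ γ j ∣ * ∣ rots j (peak j) ∣    ≡⟨ ℤP.abs-* (γ j) _ ⟨
    ∣ f j ∣                          ≡⟨ cong ∣_∣ f-j ⟩
    ∣ sumℤ f -ℤ rest ∣               ≤⟨ ℤP.∣i-j∣≤∣i∣+∣j∣ (sumℤ f) rest ⟩
    ∣ sumℤ f ∣ + ∣ rest ∣             ≤⟨ ℕP.+-monoʳ-≤ ∣ sumℤ f ∣ ∣rest∣≤ ⟩
    ∣ sumℤ f ∣ + N * (M * B)          ∎
    where
    open ℕP.≤-Reasoning
    f : Fin N → ℤ
    f l = γ l *ℤ rots l (peak j)
    rest = sumℤ (f ∘ punchIn j)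
    f-j : f j ≡ sumℤ f -ℤ rest
    f-j = trans (x≡x+y-y (f j) rest) (cong (_-ℤ rest) (sym (sumℤ-remove f j)))
      where
      x≡x+y-y : ∀ x y → x ≡ x +ℤ y -ℤ y
      x≡x+y-y = ℤSolver.solve-∀
    term≤ : ∀ k → ∣ f (punchIn j k) ∣ ≤ M * B
    term≤ k = subst (_≤ M * B) (sym (ℤP.abs-* (γ l) _))
      (ℕP.*-mono-≤ (γ≤M l) (rest≤ (rots-dominant l) (peak j) λ eq → FinP.punchInᵢ≢i j k (peak-injective (sym eq))))
      where l = punchIn j k
    ∣rest∣≤ : ∣ rest ∣ ≤ N * (M * B)
    ∣rest∣≤ = ℕP.≤-trans (∣sumℤ∣≤sumℕ∣∣ (f ∘ punchIn j))
      (ℕP.≤-trans (sumℕ≤*-bound (M * B) term≤) (ℕP.*-monoˡ-≤ (M * B) (ℕP.n≤1+n n)))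

  normSq-b≤ : normSq b ≤ A * A + N * (B * B)
  normSq-b≤ = subst (_≤ A * A + N * (B * B)) (sym (sumℕ-remove b² p))
    (ℕP.+-mono-≤ (ℕP.≤-reflexive (cong₂ _*_ (peak≡ dom) (peak≡ dom)))
      (ℕP.≤-trans (sumℕ≤*-bound (B * B) rest²≤) (ℕP.*-monoˡ-≤ (B * B) (ℕP.n≤1+n n))))
    where
    b² : Fin N → ℕ
    b² i = ∣ b i ∣ * ∣ b i ∣
    rest²≤ : ∀ k → b² (punchIn p k) ≤ B * B
    rest²≤ k = ℕP.*-mono-≤ ≤B ≤B
      where ≤B = rest≤ dom (punchIn p k) (FinP.punchInᵢ≢i p k)

  1≤normSq-b : 1 ≤ normSq b
  1≤normSq-b = ℕP.≤-trans (ℕP.*-mono-≤ 1≤A 1≤A)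
    (subst (_≤ normSq b) (cong₂ _*_ (peak≡ dom) (peak≡ dom)) (square≤normSq b p))

  peak-coordinate-bound : ∀ (γ : Fin N → ℤ) M → (∀ l → ∣ γ l ∣ ≤ M) → ∀ j → ∣ γ j ∣ ≡ M →
    7 * (M * A) ≤ 8 * ∣ lincomb γ rots (peak j) ∣
  peak-coordinate-bound γ M γ≤M j γj≡M = 7/8-bound M x
    (subst (λ m → m * A ≤ x + N * (M * B)) γj≡M (coordinate-estimate γ M γ≤M j))
    where x = ∣ lincomb γ rots (peak j) ∣

  data Shape (γ : Fin N → ℤ) : Set where
    trivial    : (∀ j → γ j ≡ 0ℤ) → Shape γ
    signed-rot : ∀ j → ∣ γ j ∣ ≡ 1 → (∀ l → l ≢ j → γ l ≡ 0ℤ) → Shape γ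
    longer     : normSq b < normSq (lincomb γ rots) → Shape γ

  -- The largest coefficient M sits over its own peak; there the combination is ≥ 7MA/8.
  longer-if-coeff≥2 : ∀ (γ : Fin N → ℤ) M → (∀ l → ∣ γ l ∣ ≤ M) → ∀ j → ∣ γ j ∣ ≡ M → 2 ≤ M →
    normSq b < normSq (lincomb γ rots)
  longer-if-coeff≥2 γ M γ≤M j γj≡M 2≤M = ℕP.≤-<-trans normSq-b≤ (ℕP.<-≤-trans
    (A²+NB²<x² 1≤A x (ℕP.≤-trans (ℕP.≤-reflexive (14a≡7[2a] A))
      (ℕP.≤-trans (ℕP.*-monoʳ-≤ 7 (ℕP.*-monoˡ-≤ A 2≤M)) (peak-coordinate-bound γ M γ≤M j γj≡M))))
    (square≤normSq (lincomb γ rots) (peak j)))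
    where
    x = ∣ lincomb γ rots (peak j) ∣
    14a≡7[2a] : ∀ a → 14 * a ≡ 7 * (2 * a)
    14a≡7[2a] = ℕSolver.solve-∀

  longer-if-two-units : ∀ (γ : Fin N → ℤ) → (∀ l → ∣ γ l ∣ ≤ 1) → ∀ {j k} → j ≢ k →
    ∣ γ j ∣ ≡ 1 → ∣ γ k ∣ ≡ 1 → normSq b < normSq (lincomb γ rots)
  longer-if-two-units γ γ≤1 {j} {k} j≢k γj≡1 γk≡1 = ℕP.≤-<-trans normSq-b≤ (ℕP.<-≤-trans
    (A²+NB²<x²+y² 1≤A (x j) (x k) (bound j γj≡1) (bound k γk≡1))
    (two-terms≤sumℕ (λ i → ∣ lincomb γ rots i ∣ * ∣ lincomb γ rots i ∣) (j≢k ∘ peak-injective)))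
    where
    x : Fin N → ℕ
    x l = ∣ lincomb γ rots (peak l) ∣
    bound : ∀ l → ∣ γ l ∣ ≡ 1 → 7 * A ≤ 8 * x l
    bound l γl≡1 = subst (λ a → 7 * a ≤ 8 * x l) (ℕP.*-identityˡ A) (peak-coordinate-bound γ 1 γ≤1 l γl≡1)

  shape : ∀ γ → Shape γ
  shape γ with argmax (λ j → ∣ γ j ∣)
  ... | j , γ≤γj with ∣ γ j ∣ in γj≡M
  ... | zero        = trivial λ l → ℤP.∣i∣≡0⇒i≡0 (ℕP.n≤0⇒n≡0 (γ≤γj l))
  ... | suc (suc m) = longer (longer-if-coeff≥2 γ _ γ≤γj j γj≡M (s≤s (s≤s z≤n)))
  ... | suc zero with FinP.any? (λ l → ¬? (l FinP.≟ j) ×-dec ¬? (γ l ℤP.≟ 0ℤ))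
  ...   | yes (l , l≢j , γl≢0) = longer (longer-if-two-units γ γ≤γj (l≢j ∘ sym) γj≡M γl≡1)
    where
    γl≡1 : ∣ γ l ∣ ≡ 1
    γl≡1 = ℕP.≤-antisym (γ≤γj l) (ℕP.n≢0⇒n>0 (γl≢0 ∘ ℤP.∣i∣≡0⇒i≡0))
  ...   | no ∄other = signed-rot j γj≡M γ≡0
    where
    γ≡0 : ∀ l → l ≢ j → γ l ≡ 0ℤ
    γ≡0 l l≢j with γ l ℤP.≟ 0ℤ
    ... | yes γl≡0 = γl≡0
    ... | no  γl≢0 = ⊥-elim (∄other (l , l≢j , γl≢0))

  lincomb-trivial : ∀ {γ} → (∀ j → γ j ≡ 0ℤ) → lincomb γ rots ≋ 0V
  lincomb-trivial {γ} γ≡0 i = sumℤ-zero λ j → trans (cong (_*ℤ rots j i) (γ≡0 j)) (ℤP.*-zeroˡ (rots j i))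

  ∣lincomb-signed-rot∣ : ∀ {γ} j → ∣ γ j ∣ ≡ 1 → (∀ l → l ≢ j → γ l ≡ 0ℤ) →
    ∀ i → ∣ lincomb γ rots i ∣ ≡ ∣ rots j i ∣
  ∣lincomb-signed-rot∣ {γ} j γj≡1 γ≡0 i =
    trans (cong ∣_∣ (lincomb-single γ rots j γ≡0 i)) (∣unit*x∣≡∣x∣ {γ j} (rots j i) γj≡1)

  normSq-signed-rot : ∀ {γ} j → ∣ γ j ∣ ≡ 1 → (∀ l → l ≢ j → γ l ≡ 0ℤ) →
    normSq (lincomb γ rots) ≡ normSq b
  normSq-signed-rot {γ} j γj≡1 γ≡0 =
    trans (normSq-∣≡∣ {x = lincomb γ rots} {rots j} (∣lincomb-signed-rot∣ j γj≡1 γ≡0)) (normSq-rots j)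

  normSq-b≤nonzero : ∀ w → Λ b w → ¬ (w ≋ 0V) → normSq b ≤ normSq w
  normSq-b≤nonzero w (γ , w≋γ·rots) w≉0 with shape γ
  ... | trivial γ≡0          = ⊥-elim (w≉0 λ i → trans (w≋γ·rots i) (lincomb-trivial γ≡0 i))
  ... | signed-rot j γj≡1 γ≡0 =
    ℕP.≤-reflexive (sym (trans (normSq-≋ {x = w} w≋γ·rots) (normSq-signed-rot j γj≡1 γ≡0)))
  ... | longer b<γ·rots      = ℕP.<⇒≤ (subst (normSq b <_) (sym (normSq-≋ {x = w} w≋γ·rots)) b<γ·rots)

  rots-independent : LinIndep rots
  rots-independent γ γ·rots≋0 j with shape γ
  ... | trivial γ≡0 = γ≡0 j
  ... | signed-rot l γl≡1 γ≡0 = ⊥-elim (ℕP.<⇒≢ 1≤normSq-b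
        (sym (trans (sym (normSq-signed-rot l γl≡1 γ≡0)) (normSq-≋0 {x = lincomb γ rots} γ·rots≋0))))
  ... | longer b<γ·rots = ⊥-elim (ℕP.n≮0 (subst (normSq b <_) (normSq-≋0 {x = lincomb γ rots} γ·rots≋0) b<γ·rots))

  rank : HasRank (Λ b) N
  rank = (rots , rots∈Λ , rots-independent) , λ _ → HasIndep⇒≤dim {Γ = Λ b}

  normSq-b≤minima : ∀ k r → HasIndepBelow (Λ b) (suc k) r → normSq b ≤ r
  normSq-b≤minima k r (u , u∈Λ , u≤r , u-indep) =
    ℕP.≤-trans (normSq-b≤nonzero (u zero) (u∈Λ zero) (LinIndep⇒≉0 {v = u} u-indep zero)) (u≤r zero)

  b-shortest : HasIndepBelow (Λ b) 1 (normSq b)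
  b-shortest = (λ _ → b) , (λ _ → rots∈Λ zero) , (λ _ → ℕP.≤-refl) , LinIndep-single p b-peak≢0
    where
    b-peak≢0 : b p ≢ 0ℤ
    b-peak≢0 bp≡0 = ℕP.<⇒≢ 1≤A (sym (trans (sym (peak≡ dom)) (cong ∣_∣ bp≡0)))

  λ₁≡ : LambdaSqEq (Λ b) 1 (normSq b)
  λ₁≡ = b-shortest , normSq-b≤minima 0

  λN≡ : LambdaSqEq (Λ b) N (normSq b)
  λN≡ = (rots , rots∈Λ , (ℕP.≤-reflexive ∘ normSq-rots) , rots-independent) , normSq-b≤minima n

  nonzero-short⇒signed-rot : ∀ w → Λ b w → ¬ (w ≋ 0V) → normSq w ≤ normSq b →
    ∃ λ j → ∃ λ ε → ∣ ε ∣ ≡ 1 × w ≋ (λ i → ε *ℤ rots j i)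
  nonzero-short⇒signed-rot w (γ , w≋γ·rots) w≉0 w≤b with shape γ
  ... | trivial γ≡0 = ⊥-elim (w≉0 λ i → trans (w≋γ·rots i) (lincomb-trivial γ≡0 i))
  ... | signed-rot j γj≡1 γ≡0 = j , γ j , γj≡1 , λ i → trans (w≋γ·rots i) (lincomb-single γ rots j γ≡0 i)
  ... | longer b<γ·rots = ⊥-elim (ℕP.<⇒≱ (subst (normSq b <_) (sym (normSq-≋ {x = w} w≋γ·rots)) b<γ·rots) w≤b)

  shortest-dominant : ∀ c → InS (Λ b) c → ∃ λ j → DominantAt c (peak j) A B
  shortest-dominant c (c∈Λ , c-shortest , c-minimal)
    with nonzero-short⇒signed-rot c c∈Λ c≉0 (c-minimal _ b-shortest)
    where
    c≉0 : ¬ (c ≋ 0V)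
    c≉0 c≋0 = ℕP.<⇒≱ 1≤normSq-b (ℕP.≤-trans (normSq-b≤minima 0 _ c-shortest)
                                            (ℕP.≤-reflexive (normSq-≋0 {x = c} c≋0)))
  ... | j , ε , ∣ε∣≡1 , c≋ε·rots =
    j , DominantAt-∣≡∣ (λ i → trans (cong ∣_∣ (c≋ε·rots i)) (∣unit*x∣≡∣x∣ {ε} (rots j i) ∣ε∣≡1))
                       (rots-dominant j)

dominant⇒InR' : ∀ {n A B} → 8 * (suc n * B) ≤ A → 1 ≤ A →
  ∀ {b p} → DominantAt b p A B → InR' (suc n) (Λ b)
dominant⇒InR' 8NB≤A 1≤A {b} dom = (b , ≐-refl , rank , λ₁≡ , λN≡) , cyclic-order
  where
  open Dominant 8NB≤A 1≤A dom
  -- shortest vectors are dominant again, so Λ c has full rank too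
  cyclic-order : ∀ c → InS (Λ b) c → CoEq c N
  cyclic-order c c∈S = Dominant.rank 8NB≤A 1≤A (proj₂ (shortest-dominant c c∈S))

funToFin-cong : ∀ {m n} {f g : Fin m → Fin n} → (∀ i → f i ≡ g i) → funToFin f ≡ funToFin g
funToFin-cong {zero}  f≗g = refl
funToFin-cong {suc m} f≗g = cong₂ combine (f≗g zero) (funToFin-cong (f≗g ∘ suc))

Count⇒≤^ : ∀ {N} {P : Sub N → Set} {m n K} → Count P m →
  (code : ∀ Γ → P Γ → Fin n → Fin K) →
  (∀ Γ Δ PΓ PΔ → (∀ i → code Γ PΓ i ≡ code Δ PΔ i) → Γ ≐ Δ) → m ≤ K ^ n
Count⇒≤^ (L , PL , L-injective , _) code code-injective =
  FinP.injective⇒≤ {f = λ j → funToFin (code (L j) (PL j))} λ {i} {j} eq →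
    L-injective i j (code-injective (L i) (L j) (PL i) (PL j) λ k →
      trans (sym (FinP.finToFun-funToFin _ k))
            (trans (cong (λ x → finToFun x k) eq) (FinP.finToFun-funToFin _ k)))

Count⇒^≤ : ∀ {N} {P : Sub N → Set} {m n K} → Count P m →
  (F : (Fin n → Fin K) → Sub N) → (∀ t → P (F t)) →
  (∀ t t' → F t ≐ F t' → ∀ i → t i ≡ t' i) → K ^ n ≤ m
Count⇒^≤ {m = m} {n} {K} (L , _ , _ , L-complete) F PF F-injective =
  FinP.injective⇒≤ {f = index} λ {x} {y} eq →
    trans (sym (FinP.funToFin-finToFin {n} {K} x)) (trans (funToFin-cong (F-injective _ _ (F-x≐F-y eq)))
                                                 (FinP.funToFin-finToFin {n} {K} y))
  where
  index : Fin (K ^ n) → Fin m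
  index x = proj₁ (L-complete (F (finToFun x)) (PF (finToFun x)))
  F≐L : ∀ x → F (finToFun x) ≐ L (index x)
  F≐L x = proj₂ (L-complete (F (finToFun x)) (PF (finToFun x)))
  F-x≐F-y : ∀ {x y} → index x ≡ index y → F (finToFun x) ≐ F (finToFun y)
  F-x≐F-y {x} {y} eq = ≐-trans (F≐L x) (subst (λ j → L j ≐ F (finToFun y)) (sym eq) (≐-sym (F≐L y)))

floorSqrt : ∀ T → ∃ λ s → s * s ≤ T × T < suc s * suc s
floorSqrt zero = 0 , z≤n , s≤s z≤n
floorSqrt (suc T) with floorSqrt T
... | s , s²≤T , T<[1+s]² with suc s * suc s ℕP.≤? suc T
...   | yes [1+s]²≤1+T = suc s , [1+s]²≤1+T ,
        ℕP.≤-<-trans T<[1+s]² (ℕP.*-mono-< (ℕP.n<1+n (suc s)) (ℕP.n<1+n (suc s)))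
...   | no  [1+s]²≰1+T = s , ℕP.m≤n⇒m≤1+n s²≤T , ℕP.≰⇒> [1+s]²≰1+T

square<⇒≤ : ∀ x s → x * x < suc s * suc s → x ≤ s
square<⇒≤ x s x²<[1+s]² with x ℕP.≤? s
... | yes x≤s = x≤s
... | no  x≰s = ⊥-elim (ℕP.<⇒≱ x²<[1+s]² (ℕP.*-mono-≤ (ℕP.≰⇒> x≰s) (ℕP.≰⇒> x≰s)))

codeℤ : ℕ → ℤ → ℕ
codeℤ s (ℤ.+ k)  = k
codeℤ s -[1+ k ] = suc s + k

codeℤ< : ∀ s z → ∣ z ∣ ≤ s → codeℤ s z < suc (s + s)
codeℤ< s (ℤ.+ k)  k≤s = s≤s (ℕP.≤-trans k≤s (ℕP.m≤m+n s s))
codeℤ< s -[1+ k ] k<s = s≤s (subst (_≤ s + s) (ℕP.+-suc s k) (ℕP.+-monoʳ-≤ s k<s))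

codeℤ-injective : ∀ s {z z'} → ∣ z ∣ ≤ s → ∣ z' ∣ ≤ s → codeℤ s z ≡ codeℤ s z' → z ≡ z'
codeℤ-injective s {ℤ.+ k}  {ℤ.+ k'}  _   _    k≡k' = cong ℤ.+_ k≡k'
codeℤ-injective s {ℤ.+ k}  { -[1+ k' ] } k≤s _  k≡ =
  ⊥-elim (ℕP.<⇒≢ (s≤s (ℕP.≤-trans k≤s (ℕP.m≤m+n s k'))) k≡)
codeℤ-injective s { -[1+ k ] } {ℤ.+ k'}  _  k'≤s ≡k' =
  ⊥-elim (ℕP.<⇒≢ (s≤s (ℕP.≤-trans k'≤s (ℕP.m≤m+n s k))) (sym ≡k'))
codeℤ-injective s { -[1+ k ] } { -[1+ k' ] } _ _  eq  = cong -[1+_] (ℕP.+-cancelˡ-≡ (suc s) k k' eq)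

generator : ∀ {N Γ} → InR N Γ → V N
generator (a , _) = a

Γ≐Λ-generator : ∀ {N Γ} (Γ∈R : InR N Γ) → Γ ≐ Λ (generator Γ∈R)
Γ≐Λ-generator (_ , Γ≐Λa , _) = Γ≐Λa

-- ‖a‖ = λ_N(Λ a), so the generator is as short as λ_N(Γ).
normSq-generator≤ : ∀ {N Γ T} (Γ∈R : InR N Γ) → LambdaNSqLe N Γ T → normSq (generator Γ∈R) ≤ T
normSq-generator≤ (_ , Γ≐Λa , _ , _ , λN≡a) (r , λN≡r , r≤T) =
  ℕP.≤-trans (proj₂ λN≡a r (HasIndepBelow-≐ Γ≐Λa (proj₁ λN≡r))) r≤T

fCount≤ : ∀ {N T m} → fCount N T m → ∀ s → T < suc s * suc s → m ≤ suc (s + s) ^ N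
fCount≤ {N} {T} count s T<[1+s]² = Count⇒≤^ {P = λ Γ → InR N Γ × LambdaNSqLe N Γ T} count code code-injective
  where
  entry≤ : ∀ {Γ} (PΓ : InR N Γ × LambdaNSqLe N Γ T) i → ∣ generator (proj₁ PΓ) i ∣ ≤ s
  entry≤ (Γ∈R , λN≤T) i = square<⇒≤ _ s (ℕP.≤-<-trans
    (ℕP.≤-trans (term≤sumℕ (λ i → ∣ a i ∣ * ∣ a i ∣) i) (normSq-generator≤ Γ∈R λN≤T)) T<[1+s]²)
    where a = generator Γ∈R
  code : ∀ Γ → InR N Γ × LambdaNSqLe N Γ T → Fin N → Fin (suc (s + s))
  code Γ PΓ i = fromℕ< (codeℤ< s (generator (proj₁ PΓ) i) (entry≤ PΓ i))
  code-injective : ∀ Γ Δ PΓ PΔ → (∀ i → code Γ PΓ i ≡ code Δ PΔ i) → Γ ≐ Δ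
  code-injective Γ Δ PΓ PΔ code≗ =
    ≐-trans (Γ≐Λ-generator (proj₁ PΓ)) (≐-trans (Λ-cong a≋a') (≐-sym (Γ≐Λ-generator (proj₁ PΔ))))
    where
    a≋a' : generator (proj₁ PΓ) ≋ generator (proj₁ PΔ)
    a≋a' i = codeℤ-injective s (entry≤ PΓ i) (entry≤ PΔ i)
      (trans (sym (FinP.toℕ-fromℕ< _)) (trans (cong toℕ (code≗ i)) (FinP.toℕ-fromℕ< _)))

∣x-q∣≤q : ∀ x q → x ≤ q + q → ∣ ℤ.+ x -ℤ ℤ.+ q ∣ ≤ q
∣x-q∣≤q x q x≤2q rewrite ℤP.[+m]-[+n]≡m⊖n x q with q ℕP.≤? x
... | yes q≤x rewrite ℤP.⊖-≥ q≤x = ℕP.m≤n+o⇒m∸n≤o x q x≤2q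
... | no  q≰x rewrite ℤP.∣⊖∣-≰ q≰x = ℕP.m∸n≤m q x

x-q-injective : ∀ q {x y} → ℤ.+ x -ℤ ℤ.+ q ≡ ℤ.+ y -ℤ ℤ.+ q → x ≡ y
x-q-injective q {x} {y} eq = ℤP.+-injective (begin
  ℤ.+ x                          ≡⟨ i≡i-j+j (ℤ.+ x) (ℤ.+ q) ⟩
  ℤ.+ x -ℤ ℤ.+ q +ℤ ℤ.+ q        ≡⟨ cong (_+ℤ ℤ.+ q) eq ⟩
  ℤ.+ y -ℤ ℤ.+ q +ℤ ℤ.+ q        ≡⟨ i≡i-j+j (ℤ.+ y) (ℤ.+ q) ⟨
  ℤ.+ y                          ∎)
  where
  open ≡-Reasoning
  i≡i-j+j : ∀ i j → i ≡ i -ℤ j +ℤ j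
  i≡i-j+j = ℤSolver.solve-∀

unit*positive⇒≡1 : ∀ {ε a a'} → ∣ ε ∣ ≡ 1 → 1 ≤ a → ε *ℤ ℤ.+ a ≡ ℤ.+ a' → ε ≡ 1ℤ
unit*positive⇒≡1 {ℤ.+ 1}                _ _         _  = refl
unit*positive⇒≡1 { -[1+ 0 ] } {suc a} _ _ ()

module DominantFamily (n q : ℕ) (1≤q : 1 ≤ q) where

  N K : ℕ
  N = suc n
  K = suc (q + q)

  peakValue : (Fin N → Fin K) → ℕ
  peakValue t = 8 * (N * q) + toℕ (t zero)

  vec : (Fin N → Fin K) → V N
  vec t zero    = ℤ.+ peakValue t
  vec t (suc i) = ℤ.+ toℕ (t (suc i)) -ℤ ℤ.+ q

  t≤2q : ∀ (t : Fin N → Fin K) i → toℕ (t i) ≤ q + q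
  t≤2q t i = ℕP.≤-pred (FinP.toℕ<n (t i))

  8Nq≤peakValue : ∀ t → 8 * (N * q) ≤ peakValue t
  8Nq≤peakValue t = ℕP.m≤m+n _ _

  q<peakValue : ∀ t → q < peakValue t
  q<peakValue t = ℕP.<-≤-trans (subst (q <_) (q*[8N]≡8[Nq] q N) q<q*[8N]) (8Nq≤peakValue t)
    where
    q<q*[8N] : q < q * (8 * N)
    q<q*[8N] = ℕP.m<m*n q (8 * N) {{>-nonZero 1≤q}} (ℕP.≤-trans (s≤s (s≤s z≤n)) (ℕP.m≤m*n 8 N))
    q*[8N]≡8[Nq] : ∀ q N → q * (8 * N) ≡ 8 * (N * q)
    q*[8N]≡8[Nq] = ℕSolver.solve-∀

  1≤peakValue : ∀ t → 1 ≤ peakValue t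
  1≤peakValue t = ℕP.≤-trans (s≤s z≤n) (q<peakValue t)

  vec-dominant : ∀ t → DominantAt (vec t) zero (peakValue t) q
  vec-dominant t = record
    { peak≡ = refl
    ; rest≤ = λ { zero 0≢0 → ⊥-elim (0≢0 refl) ; (suc i) _ → ∣x-q∣≤q _ q (t≤2q t (suc i)) } }

  module D (t : Fin N → Fin K) = Dominant (8Nq≤peakValue t) (1≤peakValue t) (vec-dominant t)

  peakValue≤10Nq : ∀ t → peakValue t ≤ 10 * (N * q)
  peakValue≤10Nq t = begin
    8 * (N * q) + toℕ (t zero)      ≤⟨ ℕP.+-monoʳ-≤ (8 * (N * q)) (t≤2q t zero) ⟩
    8 * (N * q) + (q + q)           ≤⟨ ℕP.+-monoʳ-≤ (8 * (N * q)) (ℕP.+-mono-≤ (ℕP.m≤n*m q N) (ℕP.m≤n*m q N)) ⟩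
    8 * (N * q) + (N * q + N * q)   ≡⟨ 8x+[x+x]≡10x (N * q) ⟩
    10 * (N * q)                    ∎
    where
    open ℕP.≤-Reasoning
    8x+[x+x]≡10x : ∀ x → 8 * x + (x + x) ≡ 10 * x
    8x+[x+x]≡10x = ℕSolver.solve-∀

  normSq-vec≤ : ∀ t → normSq (vec t) ≤ (17 * (N * q)) * (17 * (N * q))
  normSq-vec≤ t = begin
    normSq (vec t)                                  ≤⟨ D.normSq-b≤ t ⟩
    peakValue t * peakValue t + N * (q * q)         ≤⟨ ℕP.+-mono-≤ A²≤ (ℕP.m≤m*n _ N) ⟩
    10 * (N * q) * (10 * (N * q)) + N * (q * q) * N ≡⟨ regroup N q ⟩
    101 * ((N * q) * (N * q))                       ≤⟨ ℕP.*-monoˡ-≤ ((N * q) * (N * q)) (ℕP.m≤m+n 101 188) ⟩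
    289 * ((N * q) * (N * q))                       ≡⟨ 289x²≡[17x]² (N * q) ⟩
    (17 * (N * q)) * (17 * (N * q))                 ∎
    where
    open ℕP.≤-Reasoning
    A²≤ = ℕP.*-mono-≤ (peakValue≤10Nq t) (peakValue≤10Nq t)
    regroup : ∀ N q → 10 * (N * q) * (10 * (N * q)) + N * (q * q) * N ≡ 101 * ((N * q) * (N * q))
    regroup = ℕSolver.solve-∀
    289x²≡[17x]² : ∀ x → 289 * (x * x) ≡ (17 * x) * (17 * x)
    289x²≡[17x]² = ℕSolver.solve-∀

  vec≉0 : ∀ t → ¬ (vec t ≋ 0V)
  vec≉0 t vec≋0 = ℕP.<⇒≢ (1≤peakValue t) (sym (ℤP.+-injective (vec≋0 zero)))

  vec-≋⇒≗ : ∀ {t t'} → vec t ≋ vec t' → ∀ i → t i ≡ t' i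
  vec-≋⇒≗ vec≋ zero    = FinP.toℕ-injective (ℕP.+-cancelˡ-≡ (8 * (N * q)) _ _ (ℤP.+-injective (vec≋ zero)))
  vec-≋⇒≗ vec≋ (suc i) = FinP.toℕ-injective (x-q-injective q (vec≋ (suc i)))

  signed-rot-of-vec : ∀ t t' → (∃ λ j → ∃ λ ε → ∣ ε ∣ ≡ 1 × vec t' ≋ (λ i → ε *ℤ D.rots t j i)) →
    vec t' ≋ vec t
  signed-rot-of-vec t t' (j , ε , ∣ε∣≡1 , t'≋ε·rots) = t'≋t
    where
    -- vec t' peaks at 0 with value > q, so the rotation it is a multiple of is j = 0
    peak-j≡0 : D.peak t j ≡ zero
    peak-j≡0 with D.peak t j FinP.≟ zero
    ... | yes peak≡0 = peak≡0
    ... | no  peak≢0 = ⊥-elim (ℕP.<⇒≱ (q<peakValue t') (begin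
      peakValue t'             ≡⟨ cong ∣_∣ (t'≋ε·rots zero) ⟩
      ∣ ε *ℤ D.rots t j zero ∣  ≡⟨ ∣unit*x∣≡∣x∣ {ε} (D.rots t j zero) ∣ε∣≡1 ⟩
      ∣ D.rots t j zero ∣       ≤⟨ rest≤ (D.rots-dominant t j) zero (peak≢0 ∘ sym) ⟩
      q                        ∎))
      where open ℕP.≤-Reasoning
    j≡0 : j ≡ zero
    j≡0 = D.peak-injective t (trans peak-j≡0 (sym (shift-zero zero)))
    t'≋ε·t : vec t' ≋ (λ i → ε *ℤ vec t i)
    t'≋ε·t i = subst (λ l → vec t' i ≡ ε *ℤ D.rots t l i) j≡0 (t'≋ε·rots i)
    ε≡1 : ε ≡ 1ℤ
    ε≡1 = unit*positive⇒≡1 ∣ε∣≡1 (1≤peakValue t) (sym (t'≋ε·t zero))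
    t'≋t : vec t' ≋ vec t
    t'≋t i = trans (t'≋ε·t i) (trans (cong (_*ℤ vec t i) ε≡1) (ℤP.*-identityˡ (vec t i)))

  vec-injective : ∀ t t' → Λ (vec t) ≐ Λ (vec t') → ∀ i → t i ≡ t' i
  vec-injective t t' Λt≐Λt' = vec-≋⇒≗ (λ i → sym (signed-rot-of-vec t t'
    (D.nonzero-short⇒signed-rot t (vec t') t'∈Λt (vec≉0 t') t'≤t) i))
    where
    t'∈Λt : Λ (vec t) (vec t')
    t'∈Λt = proj₂ (Λt≐Λt' (vec t')) (D.rots∈Λ t' zero)
    t'≤t : normSq (vec t') ≤ normSq (vec t)
    t'≤t = D.normSq-b≤nonzero t' (vec t) (proj₁ (Λt≐Λt' (vec t)) (D.rots∈Λ t zero)) (vec≉0 t)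

  f'Count≥ : ∀ {T m'} → (17 * (N * q)) * (17 * (N * q)) ≤ T → f'Count N T m' → K ^ N ≤ m'
  f'Count≥ {T} [17Nq]²≤T count =
    Count⇒^≤ {P = λ Γ → InR' N Γ × LambdaNSqLe N Γ T} count (Λ ∘ vec) Λ-vec∈f' vec-injective
    where
    Λ-vec∈f' : ∀ t → InR' N (Λ (vec t)) × LambdaNSqLe N (Λ (vec t)) T
    Λ-vec∈f' t = dominant⇒InR' (8Nq≤peakValue t) (1≤peakValue t) (vec-dominant t)
               , normSq (vec t) , D.λN≡ t , ℕP.≤-trans (normSq-vec≤ t) [17Nq]²≤T

^-distribʳ-* : ∀ a b k → (a * b) ^ k ≡ a ^ k * b ^ k
^-distribʳ-* a b zero    = refl
^-distribʳ-* a b (suc k) = trans (cong (a * b *_) (^-distribʳ-* a b k)) (interchange a b (a ^ k) (b ^ k))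
  where
  interchange : ∀ a b x y → a * b * (x * y) ≡ a * x * (b * y)
  interchange = ℕSolver.solve-∀

module _ (d s : ℕ) .{{_ : NonZero d}} where

  d*[s/d]≤s : d * (s / d) ≤ s
  d*[s/d]≤s = subst (_≤ s) (ℕP.*-comm (s / d) d) (m/n*n≤m s d)

  1+2s≤2d*[1+2[s/d]] : suc (s + s) ≤ 2 * d * suc (s / d + s / d)
  1+2s≤2d*[1+2[s/d]] = begin
    suc (s + s)                 ≤⟨ ℕP.n≤1+n _ ⟩
    suc (suc (s + s))           ≡⟨ 2+2s≡2[1+s] s ⟩
    2 * suc s                   ≤⟨ ℕP.*-monoʳ-≤ 2 1+s≤d*[1+q] ⟩
    2 * (d * suc q)             ≡⟨ ℕP.*-assoc 2 d (suc q) ⟨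
    2 * d * suc q               ≤⟨ ℕP.*-monoʳ-≤ (2 * d) (s≤s (ℕP.m≤m+n q q)) ⟩
    2 * d * suc (q + q)         ∎
    where
    open ℕP.≤-Reasoning
    q = s / d
    2+2s≡2[1+s] : ∀ s → suc (suc (s + s)) ≡ 2 * suc s
    2+2s≡2[1+s] = ℕSolver.solve-∀
    1+s≤d*[1+q] : suc s ≤ d * suc q
    1+s≤d*[1+q] = begin
      suc s                  ≡⟨ cong suc (m≡m%n+[m/n]*n s d) ⟩
      suc (s % d + q * d)    ≤⟨ ℕP.+-monoˡ-≤ (q * d) (m%n<n s d) ⟩
      d + q * d              ≡⟨ d+qd≡d[1+q] d q ⟩
      d * suc q              ∎
      where
      d+qd≡d[1+q] : ∀ d q → d + q * d ≡ d * suc q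
      d+qd≡d[1+q] = ℕSolver.solve-∀

lemma3p7 : (N : ℕ) → 2 ≤ N →
    Σ ℕ λ k → Σ ℕ λ T₀ → ∀ T → T₀ ≤ T → ∀ m m' →
    fCount N T m → f'Count N T m' → m ≤ suc k * m'
-- The hypothesis 2 ≤ N only rules out N = 0; the argument works for N = 1 too.
lemma3p7 N@(suc n) _ = (34 * N) ^ N , (17 * N) * (17 * N) , bound
  where
  bound : ∀ T → (17 * N) * (17 * N) ≤ T → ∀ m m' → fCount N T m → f'Count N T m' →
    m ≤ suc ((34 * N) ^ N) * m'
  bound T T₀≤T m m' fCount-m f'Count-m' with floorSqrt T
  ... | s , s²≤T , T<[1+s]² = begin
    m                                  ≤⟨ fCount≤ fCount-m s T<[1+s]² ⟩
    suc (s + s) ^ N                    ≤⟨ ℕP.^-monoˡ-≤ N (1+2s≤2d*[1+2[s/d]] (17 * N) s) ⟩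
    (2 * (17 * N) * K) ^ N             ≡⟨ ^-distribʳ-* (2 * (17 * N)) K N ⟩
    (2 * (17 * N)) ^ N * K ^ N         ≤⟨ ℕP.*-monoʳ-≤ ((2 * (17 * N)) ^ N) K^N≤m' ⟩
    (2 * (17 * N)) ^ N * m'            ≡⟨ cong (λ a → a ^ N * m') (ℕP.*-assoc 2 17 N) ⟨
    (34 * N) ^ N * m'                  ≤⟨ ℕP.*-monoˡ-≤ m' (ℕP.n≤1+n ((34 * N) ^ N)) ⟩
    suc ((34 * N) ^ N) * m'            ∎
    where
    open ℕP.≤-Reasoning
    q = s / (17 * N)
    K = suc (q + q)
    1≤q : 1 ≤ q
    1≤q = m≥n⇒m/n>0 (square<⇒≤ (17 * N) s (ℕP.≤-<-trans T₀≤T T<[1+s]²))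
    [17Nq]²≤T : (17 * (N * q)) * (17 * (N * q)) ≤ T
    [17Nq]²≤T = ℕP.≤-trans (ℕP.*-mono-≤ 17Nq≤s 17Nq≤s) s²≤T
      where
      17Nq≤s : 17 * (N * q) ≤ s
      17Nq≤s = subst (_≤ s) (ℕP.*-assoc 17 N q) (d*[s/d]≤s (17 * N) s)
    K^N≤m' : K ^ N ≤ m'
    K^N≤m' = DominantFamily.f'Count≥ n q 1≤q [17Nq]²≤T f'Count-m'
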